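{- Let $\Omega_1=\{0,1\}^{\mathbb N\times\mathbb N}$ carry the product topology, with evaluation set $\Lambda_{\mathrm{mat}}=\{A\mapsto A(i,j):(i,j)\in\mathbb N^2\}$. Let $\Xi:\Omega_1\to\{0,1\}$ be computed by a height-$k$ tower of general algorithms ($k\ge0$), i.e. $\Xi\in\Delta^G_k$. Then $\Xi^{ -1}(1)\subset\Omega_1$ belongs to the Borel ambiguous class $\Delta^0_{k+1}=\Sigma^0_{k+1}\cap\Pi^0_{k+1}$. In particular, if $\Xi^{ -1}(1)\notin\Delta^0_{k+1}$, then $\Xi\notin\Delta^G_k$.
   Context: $\{0,1\}$ has the discrete metric. A general algorithm is a map $\Gamma:\Omega_1\to\{0,1\}$ such that for each $A$ there is a finite nonempty $\Lambda_\Gamma(A)\subset\Lambda_{\mathrm{mat}}$ with $\Gamma(A)$ depending only on $\{f(A):f\in\Lambda_\Gamma(A)\}$, and with $\Lambda_\Gamma(B)=\Lambda_\Gamma(A)$ whenever $f(B)=f(A)$ for all $f\in\Lambda_\Gamma(A)$. A tower of height $k$ is a family of general algorithms $\Gamma_{n_k,\dots,n_1}$ whose iterated pointwise limits $\lim_{n_k}\cdots\lim_{n_1}$ exist at each stage and equal $\Xi$ (height $0$: $\Xi$ is a general algorithm); $\Delta^G_k$ is the class of problems admitting a tower of height $\le k$. Borel hierarchy: $\Sigma^0_1$ = open sets, $\Pi^0_n$ = complements of $\Sigma^0_n$ sets, $\Sigma^0_{n+1}$ = countable unions of $\Pi^0_n$ sets, $\Delta^0_n=\Sigma^0_n\cap\Pi^0_n$.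 -}

module Defs where

open import Level using (Level; 0ℓ)
open import Data.Nat using (ℕ; zero; suc; _≤_)
open import Data.Bool using (Bool; true; false)
open import Data.Product using (Σ; ∃; ∃-syntax; _×_; _,_)
open import Data.List using (List; [])
open import Data.List.Membership.Propositional using (_∈_)
open import Data.Empty using (⊥)
open import Relation.Nullary using (¬_)
open import Relation.Binary.PropositionalEquality using (_≡_; _≢_)
open import Function.Bundles using (_⇔_)

-- Ω₁ = {0,1}^(ℕ×ℕ); {0,1} is represented by Bool (false = 0, true = 1).
Coord : Set
Coord = ℕ × ℕ

Ω₁ : Set
Ω₁ = Coord → Bool

Subset : Set₁
Subset = Ω₁ → Set

-- Evaluation set Λ_mat = { A ↦ A(i,j) }: an evaluation function is named
-- by its coordinate (i,j); a finite subset of Λ_mat by a list of coordinates.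
eval : Coord → Ω₁ → Bool
eval p A = A p

AgreeOn : List Coord → Ω₁ → Ω₁ → Set
AgreeOn L A B = ∀ p → p ∈ L → eval p A ≡ eval p B

SameSet : List Coord → List Coord → Set
SameSet L M = ∀ p → (p ∈ L) ⇔ (p ∈ M)

record IsGeneralAlgorithm (Γ : Ω₁ → Bool) : Set where
  field
    Λ          : Ω₁ → List Coord
    nonempty   : ∀ A → Λ A ≢ []
    depends    : ∀ A B → AgreeOn (Λ A) A B → Γ A ≡ Γ B
    consistent : ∀ A B → AgreeOn (Λ A) A B → SameSet (Λ B) (Λ A)

-- Pointwise limit in the discrete space {0,1}: eventually constant.
_⟶_ : (ℕ → Bool) → Bool → Set
s ⟶ b = ∃[ N ] (∀ n → N ≤ n → s n ≡ b)

-- Tower of height k for Ξ: Tower (suc k) Ξ gives Γ_{n_{k+1}} (the outermost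
-- index), each a tower of height k for its own limit function, and
-- lim_{n_{k+1}} Γ_{n_{k+1}}(A) = Ξ(A).
Tower : ℕ → (Ω₁ → Bool) → Set
Tower zero    Ξ = IsGeneralAlgorithm Ξ
Tower (suc k) Ξ = Σ (ℕ → Ω₁ → Bool) λ Γ →
  (∀ n → Tower k (Γ n)) × (∀ A → (λ n → Γ n A) ⟶ Ξ A)

ΔG : ℕ → (Ω₁ → Bool) → Set
ΔG k Ξ = ∃[ j ] (j ≤ k × Tower j Ξ)

-- Open sets of the product topology on Ω₁ (basis: cylinders fixing finitely
-- many coordinates).
IsOpen : Subset → Set
IsOpen U = ∀ A → U A → ∃[ L ] (∀ B → AgreeOn L A B → U B)

-- Borel hierarchy, indexed as in the paper: Σ⁰ n = Σ^0_n (n ≥ 1);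
-- Σ⁰ 0 is empty (not used).
mutual
  Σ⁰ : ℕ → Subset → Set₁
  Σ⁰ zero          U = Level.Lift _ ⊥
  Σ⁰ (suc zero)    U = Level.Lift _ (IsOpen U)
  Σ⁰ (suc (suc n)) U = Σ (ℕ → Subset) λ F →
    (∀ m → Π⁰ (suc n) (F m)) × (∀ A → U A ⇔ (∃[ m ] F m A))

  Π⁰ : ℕ → Subset → Set₁
  Π⁰ n U = Σ Subset λ V → Σ⁰ n V × (∀ A → U A ⇔ (¬ V A))

Δ⁰ : ℕ → Subset → Set₁
Δ⁰ n U = Σ⁰ n U × Π⁰ n U

preimage1 : (Ω₁ → Bool) → Subset
preimage1 Ξ A = Ξ A ≡ true

{-# OPTIONS --safe #-}
module Submission where

open import Defs
open import Level using (lift; lower)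
open import Data.Nat using (ℕ; zero; suc; _+_; _≤′_; ≤′-refl; ≤′-step)
open import Data.Nat.Properties using (+-suc; +-identityʳ; m≤m+n; m≤n+m; ≤⇒≤′)
open import Data.Bool using (Bool; true; not)
open import Data.Bool.Properties using (not-¬; ¬-not; not-involutive)
open import Data.Product using (∃-syntax; _×_; _,_; proj₁; proj₂; uncurry)
open import Relation.Nullary using (¬_)
open import Relation.Binary.PropositionalEquality using (_≡_; refl; sym; trans; cong; subst)
open import Function.Bundles using (_⇔_; mk⇔; Equivalence)

-- A map Ω₁ → {0,1} is tracked through the hierarchy by both of its fibres at
-- once: the complement of one fibre is the other, so Σ⁰ₙ fibres are also Π⁰ₙ
-- without any classical reasoning.  A general algorithm reads finitely many
-- coordinates, so its fibres are open.  If Ξ = lim Γₙ pointwise in the discrete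
-- space {0,1}, then Ξ⁻¹(b) = ⋃_N ⋂_m Γ_{N+m}⁻¹(b), a countable union of Π⁰_{j+1}
-- sets when every Γₙ has Σ⁰_{j+1} fibres.  Induction on the height of the tower
-- gives Σ⁰_{k+1} fibres, i.e. Ξ⁻¹(1) ∈ Δ⁰_{k+1}.

open Equivalence using (to; from)

⋃ : (ℕ → Subset) → Subset
⋃ U A = ∃[ m ] U m A

⋂ : (ℕ → Subset) → Subset
⋂ U A = ∀ m → U m A

fibre : (Ω₁ → Bool) → Bool → Subset
fibre f b A = f A ≡ b

Σ⁰-Measurable : ℕ → (Ω₁ → Bool) → Set₁
Σ⁰-Measurable n f = ∀ b → Σ⁰ n (fibre f b)

-- Cantor's enumeration of ℕ × ℕ, walking each antidiagonal from (d , 0) to (0 , d).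
next : ℕ × ℕ → ℕ × ℕ
next (zero  , b) = (suc b , 0)
next (suc a , b) = (a , suc b)

unpair : ℕ → ℕ × ℕ
unpair zero    = (0 , 0)
unpair (suc n) = next (unpair n)

unpair-walk : ∀ b a n → unpair n ≡ (b + a , 0) → unpair (b + n) ≡ (a , b)
unpair-walk zero    a n eq = eq
unpair-walk (suc b) a n eq =
  cong next (unpair-walk b (suc a) n (subst (λ c → unpair n ≡ (c , 0)) (sym (+-suc b a)) eq))

unpair-diagonal : ∀ d → ∃[ n ] unpair n ≡ (d , 0)
unpair-diagonal zero = 0 , refl
unpair-diagonal (suc d) with n , eq ← unpair-diagonal d =
  suc (d + n) , cong next (unpair-walk d 0 n (subst (λ c → unpair n ≡ (c , 0)) (sym (+-identityʳ d)) eq))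

unpair-surjective : ∀ a b → ∃[ n ] unpair n ≡ (a , b)
unpair-surjective a b with n , eq ← unpair-diagonal (b + a) = b + n , unpair-walk b a n eq

Σ⁰-⋃ : ∀ n {U : ℕ → Subset} → (∀ m → Σ⁰ (suc n) (U m)) → Σ⁰ (suc n) (⋃ U)
Σ⁰-⋃ zero    U-open = lift λ { A (m , u) →
  let L , nbhd = lower (U-open m) A u in L , λ B A≈B → m , nbhd B A≈B }
Σ⁰-⋃ (suc n) {U} U-Σ = F∘unpair , (λ k → uncurry F-Π (unpair k)) ,
                        λ A → mk⇔ (⋃U⇒ A) (⇒⋃U A)
  where
  F : ℕ → ℕ → Subset
  F m = proj₁ (U-Σ m)
  F-Π : ∀ m i → Π⁰ (suc n) (F m i)
  F-Π m = proj₁ (proj₂ (U-Σ m))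
  U≡⋃F : ∀ m A → U m A ⇔ ⋃ (F m) A
  U≡⋃F m = proj₂ (proj₂ (U-Σ m))
  F∘unpair : ℕ → Subset
  F∘unpair k = uncurry F (unpair k)
  ⋃U⇒ : ∀ A → ⋃ U A → ⋃ F∘unpair A
  ⋃U⇒ A (m , u) with i , f ← to (U≡⋃F m A) u with k , eq ← unpair-surjective m i =
    k , subst (λ p → uncurry F p A) (sym eq) f
  ⇒⋃U : ∀ A → ⋃ F∘unpair A → ⋃ U A
  ⇒⋃U A (k , f) = proj₁ (unpair k) , from (U≡⋃F (proj₁ (unpair k)) A) (proj₂ (unpair k) , f)

Π⁰-⋂ : ∀ n {U : ℕ → Subset} → (∀ m → Π⁰ (suc n) (U m)) → Π⁰ (suc n) (⋂ U)
Π⁰-⋂ n {U} U-Π = ⋃ V , Σ⁰-⋃ n (λ m → proj₁ (proj₂ (U-Π m))) ,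
                 λ A → mk⇔ (λ u (m , v) → to (U≡∁V m A) (u m) v)
                           (λ ¬⋃V m → from (U≡∁V m A) (λ v → ¬⋃V (m , v)))
  where
  V : ℕ → Subset
  V m = proj₁ (U-Π m)
  U≡∁V : ∀ m A → U m A ⇔ (¬ V m A)
  U≡∁V m = proj₂ (proj₂ (U-Π m))

Π⁰⇒Σ⁰-suc : ∀ n {U : Subset} → Π⁰ (suc n) U → Σ⁰ (suc (suc n)) U
Π⁰⇒Σ⁰-suc n U-Π = (λ _ → _) , (λ _ → U-Π) , λ A → mk⇔ (0 ,_) proj₂

≡⇔≢not : ∀ {x b : Bool} → x ≡ b ⇔ (¬ x ≡ not b)
≡⇔≢not {b = b} = mk⇔ not-¬ (λ x≢¬b → trans (¬-not x≢¬b) (not-involutive b))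

fibre-Π⁰ : ∀ {n f} → Σ⁰-Measurable n f → ∀ b → Π⁰ n (fibre f b)
fibre-Π⁰ {f = f} f-Σ b = fibre f (not b) , f-Σ (not b) , λ A → ≡⇔≢not

Σ⁰-Measurable-suc : ∀ {n f} → Σ⁰-Measurable (suc n) f → Σ⁰-Measurable (suc (suc n)) f
Σ⁰-Measurable-suc {n} f-Σ b = Π⁰⇒Σ⁰-suc n (fibre-Π⁰ f-Σ b)

Σ⁰-Measurable-mono : ∀ {j k f} → j ≤′ k → Σ⁰-Measurable (suc j) f → Σ⁰-Measurable (suc k) f
Σ⁰-Measurable-mono ≤′-refl        f-Σ = f-Σ
Σ⁰-Measurable-mono (≤′-step j≤′k) f-Σ = Σ⁰-Measurable-suc (Σ⁰-Measurable-mono j≤′k f-Σ)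

generalAlgorithm-Σ⁰-Measurable : ∀ {Γ} → IsGeneralAlgorithm Γ → Σ⁰-Measurable 1 Γ
generalAlgorithm-Σ⁰-Measurable Γ-alg b =
  lift λ A ΓA≡b → Λ A , λ B A≈B → trans (sym (depends A B A≈B)) ΓA≡b
  where open IsGeneralAlgorithm Γ-alg

limit≡⇔eventually≡ : ∀ {s : ℕ → Bool} {c b} → s ⟶ c → c ≡ b ⇔ (∃[ N ] ∀ m → s (N + m) ≡ b)
limit≡⇔eventually≡ (N₀ , s→c) = mk⇔
  (λ c≡b → N₀ , λ m → trans (s→c (N₀ + m) (m≤m+n N₀ m)) c≡b)
  (λ (N , s≡b) → trans (sym (s→c (N + N₀) (m≤n+m N₀ N))) (s≡b N₀))

limit-Σ⁰-Measurable : ∀ {j Ξ} (Γ : ℕ → Ω₁ → Bool) → (∀ n → Σ⁰-Measurable (suc j) (Γ n)) →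
                      (∀ A → (λ n → Γ n A) ⟶ Ξ A) → Σ⁰-Measurable (suc (suc j)) Ξ
limit-Σ⁰-Measurable {j} Γ Γ-Σ Γ→Ξ b =
  (λ N → ⋂ λ m → fibre (Γ (N + m)) b) ,
  (λ N → Π⁰-⋂ j λ m → fibre-Π⁰ (Γ-Σ (N + m)) b) ,
  λ A → limit≡⇔eventually≡ (Γ→Ξ A)

tower-Σ⁰-Measurable : ∀ j {Ξ} → Tower j Ξ → Σ⁰-Measurable (suc j) Ξ
tower-Σ⁰-Measurable zero    Ξ-alg              = generalAlgorithm-Σ⁰-Measurable Ξ-alg
tower-Σ⁰-Measurable (suc j) (Γ , Γ-tower , Γ→Ξ) =
  limit-Σ⁰-Measurable Γ (λ n → tower-Σ⁰-Measurable j (Γ-tower n)) Γ→Ξ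

ΔG-Σ⁰-Measurable : ∀ k {Ξ} → ΔG k Ξ → Σ⁰-Measurable (suc k) Ξ
ΔG-Σ⁰-Measurable k (j , j≤k , tower) = Σ⁰-Measurable-mono (≤⇒≤′ j≤k) (tower-Σ⁰-Measurable j tower)

fibre-Δ⁰ : ∀ {n f} → Σ⁰-Measurable n f → ∀ b → Δ⁰ n (fibre f b)
fibre-Δ⁰ f-Σ b = f-Σ b , fibre-Π⁰ f-Σ b

lemmaE4 : (k : ℕ) (Ξ : Ω₁ → Bool) →
    (ΔG k Ξ → Δ⁰ (suc k) (preimage1 Ξ)) ×
    (¬ Δ⁰ (suc k) (preimage1 Ξ) → ¬ ΔG k Ξ)
lemmaE4 k Ξ = ΔG⇒Δ⁰ , λ ¬Δ⁰ Ξ∈ΔG → ¬Δ⁰ (ΔG⇒Δ⁰ Ξ∈ΔG)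
  where
  ΔG⇒Δ⁰ : ΔG k Ξ → Δ⁰ (suc k) (preimage1 Ξ)
  ΔG⇒Δ⁰ Ξ∈ΔG = fibre-Δ⁰ (ΔG-Σ⁰-Measurable k Ξ∈ΔG) true
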